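{- Let $K$ be a convex subset of a normed space $X$. Then $\lnot\lnot K$ is convex.
   Context: Work in Bishop-style constructive mathematics (intuitionistic logic). For a subset $S$ of $X$, the logical complement is $\lnot S=\{x\in X: \forall y\in S\ \lnot(x=y)\}$ (i.e. the points $x$ with $x\notin S$), and $\lnot\lnot S=\lnot(\lnot S)$. -}

module Defs where

open import Level using (Level; _⊔_; suc)
open import Algebra.Bundles using (CommutativeRing)
open import Algebra.Module.Bundles using (Module)
open import Relation.Binary.Core using (Rel)
open import Relation.Nullary using (¬_)

-- Scalars: a commutative ring with an order _≤_ and an absolute value
-- (the real numbers ℝ are an instance; stdlib has no reals).
record NormedSpace (r ℓr ℓ≤ m ℓm : Level)
       : Set (suc (r ⊔ ℓr ⊔ ℓ≤ ⊔ m ⊔ ℓm)) where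
  field
    scalars : CommutativeRing r ℓr
  open CommutativeRing scalars public
  infix 4 _≤_
  field
    _≤_ : Rel Carrier ℓ≤
    ∣_∣ : Carrier → Carrier
    module' : Module scalars m ℓm
  open Module module' public using (Carrierᴹ; _≈ᴹ_; _+ᴹ_; _*ₗ_; 0ᴹ)
  field
    ‖_‖ : Carrierᴹ → Carrier
    norm-cong     : ∀ {x y} → x ≈ᴹ y → ‖ x ‖ ≈ ‖ y ‖
    norm-nonneg   : ∀ x → 0# ≤ ‖ x ‖
    norm-zero     : ∀ x → ‖ x ‖ ≈ 0# → x ≈ᴹ 0ᴹ
    norm-homog    : ∀ t x → ‖ t *ₗ x ‖ ≈ ∣ t ∣ * ‖ x ‖
    norm-triangle : ∀ x y → ‖ x +ᴹ y ‖ ≤ ‖ x ‖ + ‖ y ‖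

module _ {r ℓr ℓ≤ m ℓm : Level} (X : NormedSpace r ℓr ℓ≤ m ℓm) where
  open NormedSpace X

  Subset : (ℓ : Level) → Set (m ⊔ suc ℓ)
  Subset ℓ = Carrierᴹ → Set ℓ

  -- logical complement: ¬S = { x ∈ X : ∀ y ∈ S, ¬ (x = y) }
  ∁ : ∀ {ℓ} → Subset ℓ → Subset (m ⊔ ℓ ⊔ ℓm)
  ∁ S x = ∀ y → S y → ¬ (x ≈ᴹ y)

  Convex : ∀ {ℓ} → Subset ℓ → Set (m ⊔ ℓ ⊔ r ⊔ ℓ≤)
  Convex K = ∀ x y t → K x → K y → 0# ≤ t → t ≤ 1# →
             K ((t *ₗ x) +ᴹ ((1# + (- t)) *ₗ y))

module Submission where

open import Defs
open import Level using (Level)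
open import Algebra.Module.Bundles using (Module)
open import Algebra.Definitions using (Congruent₂)

-- A point of ∁ (∁ K) cannot fail to equal a point of K. If x and y equal points
-- k and k' of K, a congruent operation sends them to something equal to k ∙ k',
-- which lies in K; so x ∙ y cannot be equal to any point of ∁ K either.

module _ {r ℓr ℓ≤ m ℓm : Level} (X : NormedSpace r ℓr ℓ≤ m ℓm) where
  open NormedSpace X
  open Module module' using (≈ᴹ-trans; ≈ᴹ-sym; ≈ᴹ-refl)

  ∁∁-closed : ∀ {ℓ} (K : Subset X ℓ) {_∙_ : Carrierᴹ → Carrierᴹ → Carrierᴹ} →
              Congruent₂ _≈ᴹ_ _∙_ →
              (∀ {x y} → K x → K y → K (x ∙ y)) →
              ∀ {x y} → ∁ X (∁ X K) x → ∁ X (∁ X K) y → ∁ X (∁ X K) (x ∙ y)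
  ∁∁-closed K {_∙_} ∙-cong K-closed {x} {y} x∈ y∈ w w∈∁K x∙y≈w =
    x∈ x x∉K ≈ᴹ-refl
    where
    x∉K : ∁ X K x
    x∉K k k∈K x≈k = y∈ y y∉K ≈ᴹ-refl
      where
      y∉K : ∁ X K y
      y∉K k′ k′∈K y≈k′ =
        w∈∁K (k ∙ k′) (K-closed k∈K k′∈K)
             (≈ᴹ-trans (≈ᴹ-sym x∙y≈w) (∙-cong x≈k y≈k′))

proposition14 : {r ℓr ℓ≤ m ℓm ℓ : Level} (X : NormedSpace r ℓr ℓ≤ m ℓm)
    (K : Subset X ℓ) → Convex X K → Convex X (∁ X (∁ X K))
proposition14 X K convex x y t x∈ y∈ 0≤t t≤1 =
  ∁∁-closed X K
    (λ x≈x′ y≈y′ → +ᴹ-cong (*ₗ-congˡ x≈x′) (*ₗ-congˡ y≈y′))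
    (λ k∈K k′∈K → convex _ _ t k∈K k′∈K 0≤t t≤1)
    x∈ y∈
  where
  open NormedSpace X
  open Module module' using (+ᴹ-cong; *ₗ-congˡ)
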